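{- Let $m = p_1^{e_1}\cdots p_r^{e_r}$, $R=\{1,\dots,r\}$, $I\subseteq R$, and let $C_I$ be the connected component of the sequential power graph of $\mathbb{Z}/m\mathbb{Z}$ containing $d_I$. If $g_I$ is not squarefree, then $C_I$ contains at least one tail; in particular, $\pi_I$ is a tail.
   Context: $m = p_1^{e_1}\cdots p_r^{e_r}$ with distinct primes, $e_i\ge1$. For $I\subseteq R$: $\pi_I=\prod_{i\in I}p_i$, $g_I = \prod_{i\in I} p_i^{e_i}$, and $d_I$ is the idempotent with $d_I\equiv 0\pmod{p_i^{e_i}}$ for $i\in I$, $d_I\equiv1\pmod{p_j^{e_j}}$ for $j\notin I$. The sequential power graph of $\mathbb{Z}/m\mathbb{Z}$ is the directed graph on $\mathbb{Z}/m\mathbb{Z}$ with an edge $(b,c)$ iff $b\equiv a^i$, $c\equiv a^{i+1}\pmod m$ for some $a$ and $i\in\mathbb{N}$; connected components are with respect to undirected paths. An element $v$ is a tail if $v^{k+1}\not\equiv v\pmod m$ for all $k\ge1$ (equivalently, it lies in the non-periodic initial part of some orbit $a,a^2,\ldots$). -}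

module Defs where

open import Data.Nat using (ℕ; zero; suc; _+_; _*_; _^_; _≤_)
open import Data.Nat.Divisibility using (_∣_)
open import Data.Nat.Primality using (Prime)
open import Data.Fin using (Fin)
import Data.Fin as F
open import Data.Fin.Subset using (Subset)
open import Data.Vec using (lookup)
open import Data.Bool using (if_then_else_)
open import Data.Product using (∃-syntax; _×_)
open import Relation.Nullary using (¬_)
open import Relation.Binary.Construct.Closure.Equivalence using (EqClosure)
open import Relation.Binary.PropositionalEquality using (_≡_)

_≡_[mod_] : ℕ → ℕ → ℕ → Set
a ≡ b [mod m ] = ∃[ x ] ∃[ y ] (a + x * m ≡ b + y * m)

prod : ∀ {r} → (Fin r → ℕ) → ℕ
prod {zero}  f = 1
prod {suc r} f = f F.zero * prod (λ i → f (F.suc i))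

module _ {r : ℕ} (p e : Fin r → ℕ) where
  modulus : ℕ
  modulus = prod (λ i → p i ^ e i)

  πI : Subset r → ℕ
  πI I = prod (λ i → if lookup I i then p i else 1)

  gI : Subset r → ℕ
  gI I = prod (λ i → if lookup I i then p i ^ e i else 1)

  -- d is (a representative of) the idempotent d_I
  IsDI : Subset r → ℕ → Set
  IsDI I d = ∀ i → if lookup I i then (d ≡ 0 [mod p i ^ e i ])
                                 else (d ≡ 1 [mod p i ^ e i ])

SquareFree : ℕ → Set
SquareFree n = ∀ q → Prime q → ¬ (q * q ∣ n)

-- edge (b,c) of the sequential power graph of ℤ/mℤ (exponents i ∈ ℕ = {1,2,…})
SPEdge : ℕ → ℕ → ℕ → Set
SPEdge m b c = ∃[ a ] ∃[ i ] (1 ≤ i × _≡_[mod_] b (a ^ i) m × _≡_[mod_] c (a ^ suc i) m)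

SPConnected : ℕ → ℕ → ℕ → Set
SPConnected m = EqClosure (SPEdge m)

IsTail : ℕ → ℕ → Set
IsTail m v = ∀ k → 1 ≤ k → ¬ (_≡_[mod_] (v ^ suc k) v m)

module Submission where

-- Tail.  π_I is squarefree, while some p = p_i with i ∈ I has e_i ≥ 2, so
-- p² ∣ m.  Since p ∣ π_I, p² divides every π_I^(k+1) with k ≥ 1, hence a
-- congruence π_I^(k+1) ≡ π_I (mod m) would force p² ∣ π_I  (tail-criterion).
--
-- The powers π_I, π_I², … all lie in one component
-- (powers-connected).  By pigeonhole π_I^s ≡ π_I^(s+D) (mod m) for some D ≥ 1.
-- For N = D·M with M large, π_I^N ≡ 0 modulo p_i^e_i for i ∈ I (p_i ∣ π_I),
-- and π_I^N ≡ 1 modulo p_j^e_j for j ∉ I (π_I is a unit there, so π_I^D ≡ 1).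
-- By the Chinese remainder theorem π_I^N ≡ d_I (mod m), which puts d_I in the
-- component of π_I.

open import Defs
open import Data.Nat using (ℕ; zero; suc; _+_; _*_; _∸_; _^_; _≤_; NonZero; z≤n; s≤s; s≤s⁻¹; _%_; _/_; _≤?_; >-nonZero; ≢-nonZero)
open import Data.Nat.Properties
open import Data.Nat.Divisibility
open import Data.Nat.DivMod using (m≡m%n+[m/n]*n; m%n<n)
open import Data.Nat.Primality using (Prime; euclidsLemma; prime⇒irreducible; prime⇒nonZero; ¬prime[1])
open import Data.Nat.Tactic.RingSolver using (solve-∀)
open import Data.Fin using (Fin; toℕ; fromℕ<) renaming (zero to fzero; suc to fsuc)
open import Data.Fin.Properties using (pigeonhole; toℕ-fromℕ<; any?) renaming (suc-injective to fsuc-injective)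
open import Data.Fin.Subset using (Subset)
open import Data.Vec using (lookup)
open import Data.Bool using (true; false; if_then_else_)
import Data.Bool as Bool
open import Data.Product using (∃-syntax; _×_; _,_; proj₂)
open import Data.Sum using (inj₁; inj₂)
open import Data.Empty using (⊥-elim)
open import Function.Definitions using (Injective)
open import Relation.Nullary using (¬_; yes; no)
open import Relation.Nullary.Decidable using (_×-dec_)
open import Relation.Binary.PropositionalEquality
open import Relation.Binary.Construct.Closure.Equivalence using (symmetric)
open import Relation.Binary.Construct.Closure.ReflexiveTransitive using (ε; _◅_; _◅◅_)
open import Relation.Binary.Construct.Closure.Symmetric using (fwd)
open ≡-Reasoning

mod-refl : ∀ {a m} → a ≡ a [mod m ]
mod-refl = 0 , 0 , refl

mod-sym : ∀ {a b m} → a ≡ b [mod m ] → b ≡ a [mod m ]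
mod-sym (x , y , eq) = y , x , sym eq

mod-trans : ∀ {a b c m} → a ≡ b [mod m ] → b ≡ c [mod m ] → a ≡ c [mod m ]
mod-trans {a} {b} {c} {m} (x , y , a≡b) (x′ , y′ , b≡c) = x + x′ , y + y′ , (begin
  a + (x + x′) * m       ≡⟨ shift a x x′ m ⟩
  (a + x * m) + x′ * m   ≡⟨ cong (_+ x′ * m) a≡b ⟩
  (b + y * m) + x′ * m   ≡⟨ swap b y x′ m ⟩
  (b + x′ * m) + y * m   ≡⟨ cong (_+ y * m) b≡c ⟩
  (c + y′ * m) + y * m   ≡⟨ swap c y′ y m ⟩
  (c + y * m) + y′ * m   ≡⟨ sym (shift c y y′ m) ⟩
  c + (y + y′) * m       ∎)
  where
  shift : ∀ u s t n → u + (s + t) * n ≡ (u + s * n) + t * n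
  shift = solve-∀
  swap : ∀ u s t n → (u + s * n) + t * n ≡ (u + t * n) + s * n
  swap = solve-∀

mod-* : ∀ {a b c d m} → a ≡ b [mod m ] → c ≡ d [mod m ] → (a * c) ≡ (b * d) [mod m ]
mod-* {a} {b} {c} {d} {m} (x , y , a≡b) (x′ , y′ , c≡d) =
  x * c + a * x′ + x * x′ * m , y * d + b * y′ + y * y′ * m , (begin
  a * c + (x * c + a * x′ + x * x′ * m) * m ≡⟨ expand a c x x′ m ⟩
  (a + x * m) * (c + x′ * m)                ≡⟨ cong₂ _*_ a≡b c≡d ⟩
  (b + y * m) * (d + y′ * m)                ≡⟨ sym (expand b d y y′ m) ⟩
  b * d + (y * d + b * y′ + y * y′ * m) * m ∎)
  where
  expand : ∀ u v s t n → u * v + (s * v + u * t + s * t * n) * n ≡ (u + s * n) * (v + t * n)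
  expand = solve-∀

mod-^ : ∀ {a b m} n → a ≡ b [mod m ] → (a ^ n) ≡ (b ^ n) [mod m ]
mod-^ zero    a≡b = mod-refl
mod-^ (suc n) a≡b = mod-* a≡b (mod-^ n a≡b)

mod-∣ : ∀ {a b m q} → q ∣ m → a ≡ b [mod m ] → a ≡ b [mod q ]
mod-∣ {a} {b} {m} {q} (divides c m≡c*q) (x , y , eq) = x * c , y * c , (begin
  a + x * c * q ≡⟨ cong (a +_) (trans (*-assoc x c q) (cong (x *_) (sym m≡c*q))) ⟩
  a + x * m     ≡⟨ eq ⟩
  b + y * m     ≡⟨ cong (b +_) (trans (cong (y *_) m≡c*q) (sym (*-assoc y c q))) ⟩
  b + y * c * q ∎)

mod⇒∣∸ : ∀ {a b q} → a ≤ b → a ≡ b [mod q ] → q ∣ b ∸ a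
mod⇒∣∸ {a} {b} {q} a≤b (x , y , eq) = ∣m+n∣m⇒∣n (subst (q ∣_) x*q≡y*q+[b∸a] (n∣m*n x)) (n∣m*n y)
  where
  x*q≡y*q+[b∸a] : x * q ≡ y * q + (b ∸ a)
  x*q≡y*q+[b∸a] = +-cancelˡ-≡ a _ _ (begin
    a + x * q               ≡⟨ eq ⟩
    b + y * q               ≡⟨ cong (_+ y * q) (sym (m+[n∸m]≡n a≤b)) ⟩
    a + (b ∸ a) + y * q     ≡⟨ +-assoc a (b ∸ a) (y * q) ⟩
    a + ((b ∸ a) + y * q)   ≡⟨ cong (a +_) (+-comm (b ∸ a) (y * q)) ⟩
    a + (y * q + (b ∸ a))   ∎)

∣∸⇒mod : ∀ {a b q} → a ≤ b → q ∣ b ∸ a → a ≡ b [mod q ]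
∣∸⇒mod {a} {b} {q} a≤b (divides c b∸a≡c*q) = c , 0 , (begin
  a + c * q       ≡⟨ cong (a +_) (sym b∸a≡c*q) ⟩
  a + (b ∸ a)     ≡⟨ m+[n∸m]≡n a≤b ⟩
  b               ≡⟨ sym (+-identityʳ b) ⟩
  b + 0 * q       ∎)

%⇒mod : ∀ {a b} m .{{_ : NonZero m}} → a % m ≡ b % m → a ≡ b [mod m ]
%⇒mod {a} {b} m a%m≡b%m = b / m , a / m , (begin
  a + b / m * m                   ≡⟨ cong (_+ b / m * m) (m≡m%n+[m/n]*n a m) ⟩
  a % m + a / m * m + b / m * m   ≡⟨ cong (λ z → z + a / m * m + b / m * m) a%m≡b%m ⟩
  b % m + a / m * m + b / m * m   ≡⟨ swap (b % m) (a / m) (b / m) m ⟩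
  b % m + b / m * m + a / m * m   ≡⟨ cong (_+ a / m * m) (sym (m≡m%n+[m/n]*n b m)) ⟩
  b + a / m * m                   ∎)
  where
  swap : ∀ u s t n → u + s * n + t * n ≡ u + t * n + s * n
  swap = solve-∀

prime∤1 : ∀ {q} → Prime q → ¬ q ∣ 1
prime∤1 q-prime q∣1 = ¬prime[1] (subst Prime (∣1⇒≡1 q∣1) q-prime)

prime∣^⇒∣ : ∀ {q} b n → Prime q → q ∣ b ^ n → q ∣ b
prime∣^⇒∣ b zero    q-prime q∣1 = ⊥-elim (prime∤1 q-prime q∣1)
prime∣^⇒∣ b (suc n) q-prime q∣b^sn with euclidsLemma b (b ^ n) q-prime q∣b^sn
... | inj₁ q∣b   = q∣b
... | inj₂ q∣b^n = prime∣^⇒∣ b n q-prime q∣b^n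

prime∣prime⇒≡ : ∀ {q p} → Prime q → Prime p → q ∣ p → q ≡ p
prime∣prime⇒≡ q-prime p-prime q∣p with prime⇒irreducible p-prime q∣p
... | inj₁ q≡1 = ⊥-elim (¬prime[1] (subst Prime q≡1 q-prime))
... | inj₂ q≡p = q≡p

sq∤prime : ∀ {q} → Prime q → ¬ q * q ∣ q
sq∤prime {q} q-prime q²∣q =
  prime∤1 q-prime (*-cancelˡ-∣ q (subst (q * q ∣_) (sym (*-identityʳ q)) q²∣q))
  where instance _ = prime⇒nonZero q-prime

prime^-cancel : ∀ {p n} → Prime p → ¬ p ∣ n → ∀ e t → p ^ e ∣ n * t → p ^ e ∣ t
prime^-cancel p-prime p∤n zero    t _ = 1∣ t
prime^-cancel {p} {n} p-prime p∤n (suc e) t p^se∣nt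
  with euclidsLemma n t p-prime (m*n∣⇒m∣ p (p ^ e) p^se∣nt)
... | inj₁ p∣n = ⊥-elim (p∤n p∣n)
... | inj₂ (divides t′ refl) = subst (p ^ suc e ∣_) (*-comm p t′) (*-monoʳ-∣ p p^e∣t′)
  where
  instance _ = prime⇒nonZero p-prime
  p^e∣t′ : p ^ e ∣ t′
  p^e∣t′ = prime^-cancel p-prime p∤n e t′ (*-cancelˡ-∣ p
    (subst (p * p ^ e ∣_) (trans (sym (*-assoc n t′ p)) (*-comm (n * t′) p)) p^se∣nt))

prime²-cancel : ∀ {q n t} → Prime q → ¬ q ∣ n → q * q ∣ n * t → q * q ∣ t
prime²-cancel {q} {n} {t} q-prime q∤n q²∣nt =
  subst (_∣ t) (sym q*q≡q^2) (prime^-cancel q-prime q∤n 2 t (subst (_∣ n * t) q*q≡q^2 q²∣nt))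
  where
  q*q≡q^2 : q * q ≡ q ^ 2
  q*q≡q^2 = cong (q *_) (sym (*-identityʳ q))

^-mono-∣ : ∀ {a b} n → a ∣ b → a ^ n ∣ b ^ n
^-mono-∣ zero    a∣b = ∣-refl
^-mono-∣ (suc n) a∣b = *-pres-∣ a∣b (^-mono-∣ n a∣b)

^-∣-≤ : ∀ a {e N} → e ≤ N → a ^ e ∣ a ^ N
^-∣-≤ a {e} {N} e≤N = subst (a ^ e ∣_) a^e*a^[N∸e]≡a^N (m∣m*n (a ^ (N ∸ e)))
  where
  a^e*a^[N∸e]≡a^N : a ^ e * a ^ (N ∸ e) ≡ a ^ N
  a^e*a^[N∸e]≡a^N = trans (sym (^-distribˡ-+-* a e (N ∸ e))) (cong (a ^_) (m+[n∸m]≡n e≤N))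

∣prod : ∀ {r} (f : Fin r → ℕ) i → f i ∣ prod f
∣prod f fzero    = m∣m*n _
∣prod f (fsuc i) = ∣n⇒∣m*n (f fzero) (∣prod (λ j → f (fsuc j)) i)

prod-nonZero : ∀ {r} (f : Fin r → ℕ) → (∀ i → NonZero (f i)) → NonZero (prod f)
prod-nonZero {zero}  f nz = _
prod-nonZero {suc r} f nz =
  m*n≢0 (f fzero) _ {{nz fzero}} {{prod-nonZero (λ i → f (fsuc i)) (λ i → nz (fsuc i))}}

prime∣prod : ∀ {r q} → Prime q → (f : Fin r → ℕ) → q ∣ prod f → ∃[ i ] q ∣ f i
prime∣prod {zero}  q-prime f q∣1 = ⊥-elim (prime∤1 q-prime q∣1)
prime∣prod {suc r} q-prime f q∣prod with euclidsLemma (f fzero) _ q-prime q∣prod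
... | inj₁ q∣f0   = fzero , q∣f0
... | inj₂ q∣rest with prime∣prod q-prime (λ i → f (fsuc i)) q∣rest
...   | i , q∣fi = fsuc i , q∣fi

sq∤prod : ∀ {r q} → Prime q → (f : Fin r → ℕ) → (∀ i → ¬ q * q ∣ f i) →
          (∀ i j → q ∣ f i → q ∣ f j → i ≡ j) → ¬ q * q ∣ prod f
sq∤prod {zero}      q-prime f sq∤f unique q²∣1 = prime∤1 q-prime (m*n∣⇒m∣ _ _ q²∣1)
sq∤prod {suc r} {q} q-prime f sq∤f unique q²∣prod with q ∣? f fzero
... | no q∤f0 =
  sq∤prod q-prime (λ i → f (fsuc i)) (λ i → sq∤f (fsuc i))
    (λ i j q∣fi q∣fj → fsuc-injective (unique (fsuc i) (fsuc j) q∣fi q∣fj))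
    (prime²-cancel q-prime q∤f0 q²∣prod)
... | yes q∣f0 with q ∣? prod (λ i → f (fsuc i))
...   | no q∤rest =
  sq∤f fzero (prime²-cancel q-prime q∤rest (subst (q * q ∣_) (*-comm (f fzero) _) q²∣prod))
...   | yes q∣rest with prime∣prod q-prime (λ i → f (fsuc i)) q∣rest
...     | j , q∣fj with unique fzero (fsuc j) q∣f0 q∣fj
...       | ()

sumFin : ∀ {r} → (Fin r → ℕ) → ℕ
sumFin {zero}  f = 0
sumFin {suc r} f = f fzero + sumFin (λ i → f (fsuc i))

≤sumFin : ∀ {r} (f : Fin r → ℕ) i → f i ≤ sumFin f
≤sumFin f fzero    = m≤m+n _ _
≤sumFin f (fsuc i) = ≤-trans (≤sumFin (λ j → f (fsuc j)) i) (m≤n+m _ _)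

prime-powers-∣ : ∀ {r} (p e : Fin r → ℕ) → (∀ i → Prime (p i)) → Injective _≡_ _≡_ p →
                 ∀ k → (∀ i → p i ^ e i ∣ k) → prod (λ i → p i ^ e i) ∣ k
prime-powers-∣ {zero}  p e prime inj k _ = 1∣ k
prime-powers-∣ {suc r} p e prime inj k p^e∣k
  with prime-powers-∣ (λ i → p (fsuc i)) (λ i → e (fsuc i)) (λ i → prime (fsuc i))
         (λ eq → fsuc-injective (inj eq)) k (λ i → p^e∣k (fsuc i))
... | divides t k≡t*R = divides (quotient q∣t) (begin
  k                      ≡⟨ k≡t*R ⟩
  t * R                  ≡⟨ cong (_* R) (m∣n⇒n≡quotient*m q∣t) ⟩
  quotient q∣t * q * R   ≡⟨ *-assoc (quotient q∣t) q R ⟩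
  quotient q∣t * (q * R) ∎)
  where
  q R : ℕ
  q = p fzero ^ e fzero
  R = prod (λ i → p (fsuc i) ^ e (fsuc i))
  p₀∤R : ¬ p fzero ∣ R
  p₀∤R p₀∣R with prime∣prod (prime fzero) (λ i → p (fsuc i) ^ e (fsuc i)) p₀∣R
  ... | i , p₀∣p^e with inj (prime∣prime⇒≡ (prime fzero) (prime (fsuc i))
                               (prime∣^⇒∣ (p (fsuc i)) (e (fsuc i)) (prime fzero) p₀∣p^e))
  ... | ()
  q∣t : q ∣ t
  q∣t = prime^-cancel (prime fzero) p₀∤R (e fzero) t
          (subst (q ∣_) (trans k≡t*R (*-comm t R)) (p^e∣k fzero))

crt : ∀ {r} (p e : Fin r → ℕ) → (∀ i → Prime (p i)) → Injective _≡_ _≡_ p →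
      ∀ {a b} → (∀ i → a ≡ b [mod p i ^ e i ]) → a ≡ b [mod prod (λ i → p i ^ e i) ]
crt p e prime inj {a} {b} a≡b with ≤-total a b
... | inj₁ a≤b =
  ∣∸⇒mod a≤b (prime-powers-∣ p e prime inj (b ∸ a) (λ i → mod⇒∣∸ a≤b (a≡b i)))
... | inj₂ b≤a =
  mod-sym (∣∸⇒mod b≤a (prime-powers-∣ p e prime inj (a ∸ b) (λ i → mod⇒∣∸ b≤a (mod-sym (a≡b i)))))

-- The powers of a modulo m > 0 are eventually periodic (pigeonhole on a^0 … a^m).
powers-eventually-periodic : ∀ a m .{{_ : NonZero m}} →
                             ∃[ s ] ∃[ D ] (1 ≤ D × (a ^ s) ≡ (a ^ (s + D)) [mod m ])
powers-eventually-periodic a m with pigeonhole (n<1+n m) (λ k → fromℕ< (m%n<n (a ^ toℕ k) m))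
... | i , j , i<j , same-residue =
  toℕ i , toℕ j ∸ toℕ i , m<n⇒0<n∸m i<j ,
  subst (λ t → (a ^ toℕ i) ≡ (a ^ t) [mod m ]) (sym (m+[n∸m]≡n (<⇒≤ i<j)))
    (%⇒mod m (begin
      a ^ toℕ i % m                                  ≡⟨ sym (toℕ-fromℕ< _) ⟩
      toℕ (fromℕ< (m%n<n (a ^ toℕ i) m))             ≡⟨ cong toℕ same-residue ⟩
      toℕ (fromℕ< (m%n<n (a ^ toℕ j) m))             ≡⟨ toℕ-fromℕ< _ ⟩
      a ^ toℕ j % m                                  ∎))

power-vanishes : ∀ {p a e N} → p ∣ a → e ≤ N → (a ^ N) ≡ 0 [mod p ^ e ]
power-vanishes {p} {a} {e} {N} p∣a e≤N =
  mod-sym (∣∸⇒mod z≤n (∣-trans (^-∣-≤ p e≤N) (^-mono-∣ N p∣a)))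

-- If the prime p does not divide a and a^s ≡ a^(s+D) modulo p^e, then a is
-- invertible there with a^D ≡ 1, hence a^(D·M) ≡ 1 for every M.
power-unit : ∀ {p a e s D} → Prime p → ¬ p ∣ a → (a ^ s) ≡ (a ^ (s + D)) [mod p ^ e ] →
             ∀ M → (a ^ (D * M)) ≡ 1 [mod p ^ e ]
power-unit {p} {a} {e} {s} {D} p-prime p∤a periodic M =
  subst₂ (λ u v → u ≡ v [mod p ^ e ]) (^-*-assoc a D M) (^-zeroˡ M) (mod-^ M a^D≡1)
  where
  instance
    a-nonZero : NonZero a
    a-nonZero = ≢-nonZero (λ a≡0 → p∤a (subst (p ∣_) (sym a≡0) (p ∣0)))
  1≤a^D : 1 ≤ a ^ D
  1≤a^D = m^n>0 a D
  a^s≤a^[s+D] : a ^ s ≤ a ^ (s + D)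
  a^s≤a^[s+D] = ^-monoʳ-≤ a (m≤m+n s D)
  difference : a ^ (s + D) ∸ a ^ s ≡ a ^ s * (a ^ D ∸ 1)
  difference = begin
    a ^ (s + D) ∸ a ^ s         ≡⟨ cong₂ _∸_ (^-distribˡ-+-* a s D) (sym (*-identityʳ (a ^ s))) ⟩
    a ^ s * a ^ D ∸ a ^ s * 1   ≡⟨ sym (*-distribˡ-∸ (a ^ s) (a ^ D) 1) ⟩
    a ^ s * (a ^ D ∸ 1)         ∎
  p∤a^s : ¬ p ∣ a ^ s
  p∤a^s p∣a^s = p∤a (prime∣^⇒∣ a s p-prime p∣a^s)
  a^D≡1 : (a ^ D) ≡ 1 [mod p ^ e ]
  a^D≡1 = mod-sym (∣∸⇒mod 1≤a^D (prime^-cancel p-prime p∤a^s e (a ^ D ∸ 1)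
            (subst (p ^ e ∣_) difference (mod⇒∣∸ a^s≤a^[s+D] periodic))))

-- Consecutive powers of a are joined by edges, so a reaches every a^(n+1).
powers-connected : ∀ m a n → SPConnected m a (a ^ suc n)
powers-connected m a zero    = subst (SPConnected m a) (sym (*-identityʳ a)) ε
powers-connected m a (suc n) =
  powers-connected m a n ◅◅ (fwd (a , suc n , s≤s z≤n , mod-refl , mod-refl) ◅ ε)

power-connected : ∀ {m a d N} → 2 ≤ N → (a ^ N) ≡ d [mod m ] → SPConnected m a d
power-connected {N = suc zero} (s≤s ())
power-connected {m} {a} {N = suc (suc n)} _ a^N≡d =
  powers-connected m a n ◅◅ (fwd (a , suc n , s≤s z≤n , mod-refl , mod-sym a^N≡d) ◅ ε)

-- v is a tail if q ∣ v, q² ∤ v and q² ∣ m: every v^(k+1) with k ≥ 1 is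
-- divisible by q², so it cannot be ≡ v modulo m.
tail-criterion : ∀ {m v q} → q * q ∣ m → q ∣ v → ¬ q * q ∣ v → IsTail m v
tail-criterion {m} {v} {q} q²∣m q∣v q²∤v (suc k) _ (x , y , v^[k+2]≡v) =
  q²∤v (∣m+n∣m⇒∣n q²∣ym+v (∣n⇒∣m*n y q²∣m))
  where
  q²∣v^[k+2] : q * q ∣ v ^ suc (suc k)
  q²∣v^[k+2] = *-pres-∣ q∣v (∣m⇒∣m*n (v ^ k) q∣v)
  q²∣ym+v : q * q ∣ y * m + v
  q²∣ym+v = subst (q * q ∣_) (trans v^[k+2]≡v (+-comm v (y * m)))
              (∣m∣n⇒∣m+n q²∣v^[k+2] (∣n⇒∣m*n x q²∣m))

module Setting {r : ℕ} (p e : Fin r → ℕ) (prime : ∀ i → Prime (p i))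
               (inj : Injective _≡_ _≡_ p) (I : Subset r) where

  select : (Fin r → ℕ) → Fin r → ℕ
  select f i = if lookup I i then f i else 1

  -- Products over I of families that equal p_i on I (such as π_I, and g_I when
  -- all exponents in I are 1) are squarefree, and their prime divisors are
  -- exactly the p_i with i ∈ I.
  module Selection (f : Fin r → ℕ) (f≡p : ∀ i → lookup I i ≡ true → f i ≡ p i) where

    selected : ∀ {i} → lookup I i ≡ true → select f i ≡ p i
    selected {i} i∈I rewrite i∈I = f≡p i i∈I

    selected-divisor : ∀ {q} i → Prime q → q ∣ select f i → lookup I i ≡ true × q ≡ p i
    selected-divisor i q-prime q∣fi with lookup I i in i∈I
    ... | true  = refl , prime∣prime⇒≡ q-prime (prime i) (subst (_ ∣_) (f≡p i i∈I) q∣fi)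
    ... | false = ⊥-elim (prime∤1 q-prime q∣fi)

    selection-squarefree : SquareFree (prod (select f))
    selection-squarefree q q-prime = sq∤prod q-prime (select f) sq∤factor unique
      where
      sq∤factor : ∀ i → ¬ q * q ∣ select f i
      sq∤factor i q²∣fi with selected-divisor i q-prime (m*n∣⇒m∣ q q q²∣fi)
      ... | i∈I , refl = sq∤prime q-prime (subst (q * q ∣_) (selected i∈I) q²∣fi)
      unique : ∀ i j → q ∣ select f i → q ∣ select f j → i ≡ j
      unique i j q∣fi q∣fj =
        inj (trans (sym (proj₂ (selected-divisor i q-prime q∣fi))) (proj₂ (selected-divisor j q-prime q∣fj)))

  open Selection p (λ _ _ → refl) using (selected; selected-divisor) renaming (selection-squarefree to π-squarefree)

  p∣π : ∀ {i} → lookup I i ≡ true → p i ∣ πI p e I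
  p∣π {i} i∈I = subst (_∣ πI p e I) (selected i∈I) (∣prod (select p) i)

  p∤π : ∀ {j} → lookup I j ≡ false → ¬ p j ∣ πI p e I
  p∤π {j} j∉I p∣π with prime∣prod (prime j) (select p) p∣π
  ... | i , p∣fi with selected-divisor i (prime j) p∣fi
  ... | i∈I , pj≡pi with inj pj≡pi
  ... | refl with trans (sym j∉I) i∈I
  ... | ()

  large-exponent : (∀ i → 1 ≤ e i) → ¬ SquareFree (gI p e I) → ∃[ i ] (lookup I i ≡ true × 2 ≤ e i)
  large-exponent e≥1 g-not-squarefree with any? (λ i → (lookup I i Bool.≟ true) ×-dec (2 ≤? e i))
  ... | yes found = found
  ... | no none   = ⊥-elim (g-not-squarefree (Selection.selection-squarefree (λ i → p i ^ e i) p^e≡p))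
    where
    p^e≡p : ∀ i → lookup I i ≡ true → p i ^ e i ≡ p i
    p^e≡p i i∈I = trans (cong (p i ^_) e≡1) (*-identityʳ (p i))
      where
      e≡1 : e i ≡ 1
      e≡1 = ≤-antisym (s≤s⁻¹ (≰⇒> (λ 2≤e → none (i , i∈I , 2≤e)))) (e≥1 i)

  -- π_I is a tail: p_i² ∣ m for the i found above, p_i ∣ π_I, and π_I is squarefree.
  π-tail : (∀ i → 1 ≤ e i) → ¬ SquareFree (gI p e I) → IsTail (modulus p e) (πI p e I)
  π-tail e≥1 g-not-squarefree with large-exponent e≥1 g-not-squarefree
  ... | i , i∈I , 2≤e = tail-criterion p²∣m (p∣π i∈I) (π-squarefree (p i) (prime i))
    where
    p²∣m : p i * p i ∣ modulus p e
    p²∣m = ∣-trans (subst (_∣ p i ^ e i) (cong (p i *_) (*-identityʳ (p i))) (^-∣-≤ (p i) 2≤e))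
                   (∣prod (λ j → p j ^ e j) i)

  -- m > 0, so residues modulo m form a finite set.
  instance
    modulus-nonZero : NonZero (modulus p e)
    modulus-nonZero = prod-nonZero _ (λ i → m^n≢0 (p i) (e i) {{prime⇒nonZero (prime i)}})

  -- Some power π_I^N with N ≥ 2 is ≡ d_I modulo m: take N a multiple of the
  -- period of π_I's powers exceeding every e_i.
  π-power≡d : ∀ {d} → IsDI p e I d → ∃[ N ] (2 ≤ N × (πI p e I ^ N) ≡ d [mod modulus p e ])
  π-power≡d {d} isDI with powers-eventually-periodic (πI p e I) (modulus p e)
  ... | s , D , 1≤D , periodic = N , ≤-trans (m≤m+n 2 _) M≤N , crt p e prime inj π^N≡d
    where
    M N : ℕ
    M = 2 + sumFin e
    N = D * M
    M≤N : M ≤ N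
    M≤N = m≤n*m M D {{>-nonZero 1≤D}}
    π^N≡d : ∀ i → (πI p e I ^ N) ≡ d [mod p i ^ e i ]
    π^N≡d i with lookup I i in i∈I | isDI i
    ... | true  | d≡0 = mod-trans (power-vanishes (p∣π i∈I) e≤N) (mod-sym d≡0)
      where
      e≤N : e i ≤ N
      e≤N = ≤-trans (≤sumFin e i) (≤-trans (m≤n+m (sumFin e) 2) M≤N)
    ... | false | d≡1 = mod-trans (power-unit {e = e i} {s} {D} (prime i) (p∤π i∈I) periodic-at-i M)
                                  (mod-sym d≡1)
      where
      periodic-at-i : (πI p e I ^ s) ≡ (πI p e I ^ (s + D)) [mod p i ^ e i ]
      periodic-at-i = mod-∣ (∣prod (λ j → p j ^ e j) i) periodic

mainTheorem9 : (r : ℕ) (p e : Fin r → ℕ) → (∀ i → Prime (p i)) → Injective _≡_ _≡_ p → (∀ i → 1 ≤ e i) →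
    (I : Subset r) (d : ℕ) → IsDI p e I d → ¬ SquareFree (gI p e I) →
    (∃[ v ] (SPConnected (modulus p e) d v × IsTail (modulus p e) v))
    × (SPConnected (modulus p e) d (πI p e I) × IsTail (modulus p e) (πI p e I))
mainTheorem9 r p e prime inj e≥1 I d isDI g-not-squarefree =
  (πI p e I , d~π , π-is-tail) , d~π , π-is-tail
  where
  open Setting p e prime inj I
  π-is-tail : IsTail (modulus p e) (πI p e I)
  π-is-tail = π-tail e≥1 g-not-squarefree
  d~π : SPConnected (modulus p e) d (πI p e I)
  d~π with π-power≡d isDI
  ... | N , 2≤N , π^N≡d = symmetric _ (power-connected 2≤N π^N≡d)
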